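{- Let $\omega=e^{2\pi i/3}$ and, for $\alpha\in\mathbb C$ and $n=0,1,2,\dots$, define $$B_n^\alpha(t)=\frac1{n!}\sum_{k=0}^n\frac{(\omega t)_k(\omega^2t)_k(\alpha+t)_{n-k}(\alpha-t+k)_{n-k}}{k!\,(n-k)!}.$$ Then $$\sum_{n=0}^\infty B_n^\alpha(t)z^n=(1-z)^{1-2\alpha}\sum_{n=0}^\infty B_n^{1-\alpha}(t)z^n .$$
   Context: $(a)_n=a(a+1)\cdots(a+n-1)$ (with $(a)_0=1$) is the Pochhammer symbol. The identity is understood as an identity of power series in $z$ (for $|z|<1$, with $(1-z)^{1-2\alpha}$ the principal branch equal to $1$ at $z=0$). -}

module Defs where

open import Level using (Level)
open import Data.Nat using (ℕ; zero; suc; _∸_)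
open import Algebra.Bundles using (CommutativeRing)

-- All definitions are relative to a commutative ring R (playing the role of ℂ),
-- an element ω (the cube root of unity) and a family inv with inv n = 1/(n+1).
module Series {c ℓ : Level} (R : CommutativeRing c ℓ) (ω : CommutativeRing.Carrier R)
              (inv : ℕ → CommutativeRing.Carrier R) where
  open CommutativeRing R hiding (zero)

  nat : ℕ → Carrier
  nat zero    = 0#
  nat (suc n) = 1# + nat n

  poch : Carrier → ℕ → Carrier
  poch a zero    = 1#
  poch a (suc n) = poch a n * (a + nat n)

  -- 1 / n!  (= inv 0 * inv 1 * ... * inv (n-1))
  invFact : ℕ → Carrier
  invFact zero    = 1#
  invFact (suc n) = invFact n * inv n

  sumTo : (ℕ → Carrier) → ℕ → Carrier
  sumTo f zero    = f zero
  sumTo f (suc n) = sumTo f n + f (suc n)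

  B : Carrier → Carrier → ℕ → Carrier
  B α t n = invFact n * sumTo (λ k →
      poch (ω * t) k * poch ((ω * ω) * t) k
      * poch (α + t) (n ∸ k) * poch ((α - t) + nat k) (n ∸ k)
      * (invFact k * invFact (n ∸ k))) n

  -- power series as coefficient sequences; Cauchy product
  _⋆_ : (ℕ → Carrier) → (ℕ → Carrier) → ℕ → Carrier
  (f ⋆ g) n = sumTo (λ k → f k * g (n ∸ k)) n

  -- coefficients of the binomial series (1-z)^β = Σ_n (-β)_n / n! z^n
  -- (principal branch, equal to 1 at z = 0)
  oneMinusPow : Carrier → ℕ → Carrier
  oneMinusPow β n = poch (- β) n * invFact n

module Submission where

-- For each k, the part of B_n^α(t) of degree n-k in z is a ₂F₁ coefficient:
--   Σ_n B_n^α(t) z^n = Σ_k c_k z^k ₂F₁(α+t, α-t+k; k+1; z) / k!,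
--   c_k = (ωt)_k (ω²t)_k / k!.
-- Euler's transformation ₂F₁(a, b; c; z) = (1-z)^(c-a-b) ₂F₁(c-b, c-a; c; z)
-- with c = k+1 turns the k-th summand into (1-z)^(1-2α) times the k-th summand
-- for 1-α, because c-a-b = 1-2α does not depend on k; pulling this common
-- factor out of the sum gives the theorem.

open import Defs
open import Data.Nat using (ℕ; suc)
open import Algebra.Bundles using (CommutativeRing)

open import Data.Nat as N using (zero; _≤_; z≤n)
import Data.Nat.Properties as NP
open import Data.Integer as Z using (ℤ; +_; -[1+_])
import Data.Integer.Properties as ZP
open import Data.Maybe using (Maybe; just; nothing)
open import Relation.Nullary using (yes; no)
open import Relation.Binary.PropositionalEquality as P using (_≡_)
open import Algebra.Solver.Ring.AlmostCommutativeRing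
  using (fromCommutativeRing; _-Raw-AlmostCommutative⟶_)
import Algebra.Solver.Ring

-- The integers map into every commutative ring; this homomorphism makes the
-- generic ring solver available with integer coefficients, which is needed
-- because the identities below involve subtraction.
module IntegerCoefficients {c ℓ} (R : CommutativeRing c ℓ) where
  open CommutativeRing R
  open import Algebra.Properties.Ring ring using (-‿distribˡ-*; -‿distribʳ-*)
  open import Algebra.Properties.Group +-group using (ε⁻¹≈ε; ⁻¹-involutive)
  open import Algebra.Properties.AbelianGroup +-abelianGroup using (⁻¹-∙-comm; xyx⁻¹≈y)
  open import Algebra.Properties.Semiring.Mult.TCOptimised semiring using (_×_; 1+×; ×-homo-+; ×1-homo-*)
  open import Relation.Binary.Reasoning.Setoid setoid

  ι : ℤ → Carrier
  ι (+ n)      = n × 1#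
  ι -[1+ n ]   = - (suc n × 1#)

  ι-neg : ∀ i → ι (Z.- i) ≈ - ι i
  ι-neg (+ zero)   = sym ε⁻¹≈ε
  ι-neg (+ suc n)  = refl
  ι-neg -[1+ n ]   = sym (⁻¹-involutive _)

  ι-⊖ : ∀ m n → ι (m Z.⊖ n) ≈ m × 1# - n × 1#
  ι-⊖ m       zero    = sym (trans (+-congˡ ε⁻¹≈ε) (+-identityʳ _))
  ι-⊖ zero    (suc n) = sym (+-identityˡ _)
  ι-⊖ (suc m) (suc n) = begin
    ι (suc m Z.⊖ suc n)                   ≡⟨ P.cong ι (ZP.[1+m]⊖[1+n]≡m⊖n m n) ⟩
    ι (m Z.⊖ n)                           ≈⟨ ι-⊖ m n ⟩
    m × 1# - n × 1#                       ≈⟨ +-congʳ (xyx⁻¹≈y 1# (m × 1#)) ⟨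
    ((1# + m × 1#) - 1#) - n × 1#         ≈⟨ +-assoc _ _ _ ⟩
    (1# + m × 1#) + (- 1# - n × 1#)       ≈⟨ +-congˡ (⁻¹-∙-comm 1# (n × 1#)) ⟩
    (1# + m × 1#) - (1# + n × 1#)         ≈⟨ +-cong (1+× m 1#) (-‿cong (1+× n 1#)) ⟨
    suc m × 1# - suc n × 1#               ∎

  ι-+ : ∀ i j → ι (i Z.+ j) ≈ ι i + ι j
  ι-+ (+ m)      (+ n)      = ×-homo-+ 1# m n
  ι-+ (+ m)      -[1+ n ]   = ι-⊖ m (suc n)
  ι-+ -[1+ m ]   (+ n)      = trans (ι-⊖ n (suc m)) (+-comm _ _)
  ι-+ -[1+ m ]   -[1+ n ]   = begin
    - (suc (suc (m N.+ n)) × 1#)           ≡⟨ P.cong (λ x → - (suc x × 1#)) (P.sym (NP.+-suc m n)) ⟩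
    - ((suc m N.+ suc n) × 1#)             ≈⟨ -‿cong (×-homo-+ 1# (suc m) (suc n)) ⟩
    - (suc m × 1# + suc n × 1#)            ≈⟨ ⁻¹-∙-comm _ _ ⟨
    - (suc m × 1#) + - (suc n × 1#)        ∎

  ι-*-pos : ∀ m n → ι (+ m Z.* + n) ≈ m × 1# * n × 1#
  ι-*-pos m n = trans (reflexive (P.cong ι (P.sym (ZP.pos-* m n)))) (×1-homo-* m n)

  ι-* : ∀ i j → ι (i Z.* j) ≈ ι i * ι j
  ι-* (+ m)      (+ n)      = ι-*-pos m n
  ι-* (+ m)      -[1+ n ]   = begin
    ι (+ m Z.* Z.- (+ suc n))              ≡⟨ P.cong ι (P.sym (ZP.neg-distribʳ-* (+ m) (+ suc n))) ⟩
    ι (Z.- (+ m Z.* + suc n))              ≈⟨ ι-neg (+ m Z.* + suc n) ⟩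
    - ι (+ m Z.* + suc n)                  ≈⟨ -‿cong (ι-*-pos m (suc n)) ⟩
    - (m × 1# * suc n × 1#)                ≈⟨ -‿distribʳ-* _ _ ⟩
    m × 1# * - (suc n × 1#)                ∎
  ι-* -[1+ m ]   (+ n)      = begin
    ι (Z.- (+ suc m) Z.* + n)              ≡⟨ P.cong ι (P.sym (ZP.neg-distribˡ-* (+ suc m) (+ n))) ⟩
    ι (Z.- (+ suc m Z.* + n))              ≈⟨ ι-neg (+ suc m Z.* + n) ⟩
    - ι (+ suc m Z.* + n)                  ≈⟨ -‿cong (ι-*-pos (suc m) n) ⟩
    - (suc m × 1# * n × 1#)                ≈⟨ -‿distribˡ-* _ _ ⟩
    - (suc m × 1#) * n × 1#                ∎
  ι-* -[1+ m ]   -[1+ n ]   = begin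
    ι (+ suc m Z.* + suc n)                ≈⟨ ι-*-pos (suc m) (suc n) ⟩
    suc m × 1# * suc n × 1#                ≈⟨ *-congʳ (⁻¹-involutive _) ⟨
    - - (suc m × 1#) * suc n × 1#          ≈⟨ -‿distribˡ-* _ _ ⟨
    - (- (suc m × 1#) * suc n × 1#)        ≈⟨ -‿distribʳ-* _ _ ⟩
    - (suc m × 1#) * - (suc n × 1#)        ∎

  ι-homomorphism : Z.+-*-rawRing -Raw-AlmostCommutative⟶ fromCommutativeRing R
  ι-homomorphism = record
    { ⟦_⟧ = ι ; +-homo = ι-+ ; *-homo = ι-* ; -‿homo = ι-neg
    ; 0-homo = refl ; 1-homo = refl }

  ι-equal? : ∀ i j → Maybe (ι i ≈ ι j)
  ι-equal? i j with i Z.≟ j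
  ... | yes i≡j = just (reflexive (P.cong ι i≡j))
  ... | no  _   = nothing

  open Algebra.Solver.Ring Z.+-*-rawRing (fromCommutativeRing R) ι-homomorphism ι-equal? public

module Development {c ℓ} (R : CommutativeRing c ℓ) (ω : CommutativeRing.Carrier R)
                   (inv : ℕ → CommutativeRing.Carrier R) where
  open CommutativeRing R hiding (zero)
  open Series R ω inv
  open IntegerCoefficients R using (solve; _:=_; _:+_; _:-_; _:*_; :-_; con)
  open import Relation.Binary.Reasoning.Setoid setoid

  -- Finite sums Σ_{j ≤ n}.

  sumTo-cong : ∀ {f g : ℕ → Carrier} n → (∀ j → j ≤ n → f j ≈ g j) → sumTo f n ≈ sumTo g n
  sumTo-cong zero    f≈g = f≈g 0 z≤n
  sumTo-cong (suc n) f≈g = +-cong (sumTo-cong n (λ j j≤n → f≈g j (NP.m≤n⇒m≤1+n j≤n)))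
                                  (f≈g (suc n) NP.≤-refl)

  sumTo-+ : ∀ (f g : ℕ → Carrier) n → sumTo (λ j → f j + g j) n ≈ sumTo f n + sumTo g n
  sumTo-+ f g zero    = refl
  sumTo-+ f g (suc n) = trans (+-congʳ (sumTo-+ f g n))
    (solve 4 (λ a b x y → (a :+ b) :+ (x :+ y) := (a :+ x) :+ (b :+ y)) refl _ _ _ _)

  sumTo-*ˡ : ∀ x (f : ℕ → Carrier) n → x * sumTo f n ≈ sumTo (λ j → x * f j) n
  sumTo-*ˡ x f zero    = refl
  sumTo-*ˡ x f (suc n) = trans (distribˡ _ _ _) (+-congʳ (sumTo-*ˡ x f n))

  sumTo-head : ∀ (f : ℕ → Carrier) n → sumTo f (suc n) ≈ f 0 + sumTo (λ j → f (suc j)) n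
  sumTo-head f zero    = refl
  sumTo-head f (suc n) = trans (+-congʳ (sumTo-head f n)) (+-assoc _ _ _)

  suc-∸ : ∀ {n j} → j ≤ n → suc n N.∸ j ≡ suc (n N.∸ j)
  suc-∸ j≤n = NP.+-∸-assoc 1 j≤n

  sumTo-reverse : ∀ (f : ℕ → Carrier) n → sumTo f n ≈ sumTo (λ j → f (n N.∸ j)) n
  sumTo-reverse f zero    = refl
  sumTo-reverse f (suc n) = begin
    sumTo f (suc n)                               ≈⟨ sumTo-head f n ⟩
    f 0 + sumTo (λ j → f (suc j)) n               ≈⟨ +-congˡ (sumTo-reverse (λ j → f (suc j)) n) ⟩
    f 0 + sumTo (λ j → f (suc (n N.∸ j))) n       ≈⟨ +-comm _ _ ⟩
    sumTo (λ j → f (suc (n N.∸ j))) n + f 0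
      ≈⟨ +-cong (sumTo-cong n (λ j j≤n → reflexive (P.cong f (P.sym (suc-∸ j≤n)))))
                (reflexive (P.cong f (P.sym (NP.n∸n≡0 n)))) ⟩
    sumTo (λ j → f (suc n N.∸ j)) (suc n)         ∎

  telescope : ∀ (x y G : ℕ → Carrier) n → (∀ j → j ≤ n → x j + G j ≈ y j + G (suc j)) →
              sumTo x n + G 0 ≈ sumTo y n + G (suc n)
  telescope x y G zero    step = step 0 z≤n
  telescope x y G (suc n) step = begin
    (sumTo x n + x (suc n)) + G 0      ≈⟨ solve 3 (λ a b c → (a :+ b) :+ c := (a :+ c) :+ b) refl _ _ _ ⟩
    (sumTo x n + G 0) + x (suc n)      ≈⟨ +-congʳ (telescope x y G n (λ j j≤n → step j (NP.m≤n⇒m≤1+n j≤n))) ⟩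
    (sumTo y n + G (suc n)) + x (suc n)
      ≈⟨ solve 3 (λ a b c → (a :+ b) :+ c := a :+ (c :+ b)) refl _ _ _ ⟩
    sumTo y n + (x (suc n) + G (suc n)) ≈⟨ +-congˡ (step (suc n) NP.≤-refl) ⟩
    sumTo y n + (y (suc n) + G (suc (suc n)))
      ≈⟨ sym (+-assoc _ _ _) ⟩
    (sumTo y n + y (suc n)) + G (suc (suc n)) ∎

  triangle : (ℕ → ℕ → Carrier) → ℕ → Carrier
  triangle g n = sumTo (λ j → sumTo (g j) (n N.∸ j)) n

  antidiagonal : (ℕ → ℕ → Carrier) → ℕ → Carrier
  antidiagonal g n = sumTo (λ j → g j (n N.∸ j)) n

  triangle-suc : ∀ g n → triangle g (suc n) ≈ triangle g n + antidiagonal g (suc n)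
  triangle-suc g n = begin
    sumTo (λ j → sumTo (g j) (suc n N.∸ j)) n + sumTo (g (suc n)) (n N.∸ n)
      ≈⟨ +-cong (sumTo-cong n (λ j j≤n → reflexive (P.cong (sumTo (g j)) (suc-∸ j≤n))))
                (reflexive (P.cong (sumTo (g (suc n))) (NP.n∸n≡0 n))) ⟩
    sumTo (λ j → sumTo (g j) (n N.∸ j) + g j (suc (n N.∸ j))) n + g (suc n) 0
      ≈⟨ +-congʳ (sumTo-+ _ _ n) ⟩
    (triangle g n + sumTo (λ j → g j (suc (n N.∸ j))) n) + g (suc n) 0
      ≈⟨ +-assoc _ _ _ ⟩
    triangle g n + (sumTo (λ j → g j (suc (n N.∸ j))) n + g (suc n) 0)
      ≈⟨ +-congˡ (+-cong (sumTo-cong n (λ j j≤n → reflexive (P.cong (g j) (P.sym (suc-∸ j≤n)))))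
                         (reflexive (P.cong (g (suc n)) (P.sym (NP.n∸n≡0 n))))) ⟩
    triangle g n + antidiagonal g (suc n) ∎

  antidiagonal-transpose : ∀ g n → antidiagonal g n ≈ antidiagonal (λ i j → g j i) n
  antidiagonal-transpose g n = trans (sumTo-reverse (λ j → g j (n N.∸ j)) n)
    (sumTo-cong n (λ i i≤n → reflexive (P.cong (g (n N.∸ i)) (NP.m∸[m∸n]≡n i≤n))))

  triangle-transpose : ∀ g n → triangle g n ≈ triangle (λ i j → g j i) n
  triangle-transpose g zero    = refl
  triangle-transpose g (suc n) = begin
    triangle g (suc n)                                        ≈⟨ triangle-suc g n ⟩
    triangle g n + antidiagonal g (suc n)
      ≈⟨ +-cong (triangle-transpose g n) (antidiagonal-transpose g (suc n)) ⟩
    triangle g' n + antidiagonal g' (suc n)                   ≈⟨ triangle-suc g' n ⟨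
    triangle g' (suc n)                                       ∎
    where g' = λ i j → g j i

  -- Cauchy products of coefficient sequences.

  ⋆-cong : ∀ {f f' g g' : ℕ → Carrier} → (∀ i → f i ≈ f' i) → (∀ i → g i ≈ g' i) →
           ∀ n → (f ⋆ g) n ≈ (f' ⋆ g') n
  ⋆-cong f≈f' g≈g' n = sumTo-cong n (λ j _ → *-cong (f≈f' j) (g≈g' (n N.∸ j)))

  ∸-swap : ∀ n a b → n N.∸ a N.∸ b ≡ n N.∸ b N.∸ a
  ∸-swap n a b = P.trans (NP.∸-+-assoc n a b)
    (P.trans (P.cong (n N.∸_) (NP.+-comm a b)) (P.sym (NP.∸-+-assoc n b a)))

  ⋆-pull : ∀ (c p : ℕ → Carrier) (G : ℕ → ℕ → Carrier) n →
           sumTo (λ k → c k * (p ⋆ G k) (n N.∸ k)) n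
             ≈ (p ⋆ (λ m → sumTo (λ k → c k * G k (m N.∸ k)) m)) n
  ⋆-pull c p G n = begin
    sumTo (λ k → c k * (p ⋆ G k) (n N.∸ k)) n
      ≈⟨ sumTo-cong n (λ k _ → sumTo-*ˡ (c k) _ (n N.∸ k)) ⟩
    triangle (λ k j → c k * (p j * G k (n N.∸ k N.∸ j))) n
      ≈⟨ triangle-transpose _ n ⟩
    triangle (λ j k → c k * (p j * G k (n N.∸ k N.∸ j))) n
      ≈⟨ sumTo-cong n (λ j _ → trans (sumTo-cong (n N.∸ j) (λ k _ → regroup j k))
                                     (sym (sumTo-*ˡ (p j) _ (n N.∸ j)))) ⟩
    (p ⋆ (λ m → sumTo (λ k → c k * G k (m N.∸ k)) m)) n ∎
    where
    regroup : ∀ j k → c k * (p j * G k (n N.∸ k N.∸ j)) ≈ p j * (c k * G k (n N.∸ j N.∸ k))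
    regroup j k = trans (solve 3 (λ x y z → x :* (y :* z) := y :* (x :* z)) refl (c k) (p j) _)
                        (reflexive (P.cong (λ m → p j * (c k * G k m)) (∸-swap n k j)))

  recurrence-unique : ∀ (d e q f g : ℕ → Carrier) → (∀ N → e N * d N ≈ 1#) →
                      (∀ N → d N * f (suc N) ≈ q N * f N) →
                      (∀ N → d N * g (suc N) ≈ q N * g N) →
                      f 0 ≈ g 0 → ∀ N → f N ≈ g N
  recurrence-unique d e q f g ed≈1 rec-f rec-g f0≈g0 = go
    where
    cancel : ∀ N x → x ≈ e N * (d N * x)
    cancel N x = begin
      x                 ≈⟨ *-identityˡ x ⟨
      1# * x            ≈⟨ *-congʳ (ed≈1 N) ⟨
      (e N * d N) * x   ≈⟨ *-assoc _ _ _ ⟩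
      e N * (d N * x)   ∎
    go : ∀ N → f N ≈ g N
    go zero    = f0≈g0
    go (suc N) = begin
      f (suc N)                  ≈⟨ cancel N (f (suc N)) ⟩
      e N * (d N * f (suc N))    ≈⟨ *-congˡ (rec-f N) ⟩
      e N * (q N * f N)          ≈⟨ *-congˡ (*-congˡ (go N)) ⟩
      e N * (q N * g N)          ≈⟨ *-congˡ (rec-g N) ⟨
      e N * (d N * g (suc N))    ≈⟨ cancel N (g (suc N)) ⟨
      g (suc N)                  ∎

  -- Pochhammer symbols and hypergeometric coefficients.

  nat-+ : ∀ m n → nat (m N.+ n) ≈ nat m + nat n
  nat-+ zero    n = sym (+-identityˡ _)
  nat-+ (suc m) n = trans (+-congˡ (nat-+ m n)) (sym (+-assoc _ _ _))

  poch-cong : ∀ {a a'} → a ≈ a' → ∀ n → poch a n ≈ poch a' n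
  poch-cong a≈a' zero    = refl
  poch-cong a≈a' (suc n) = *-cong (poch-cong a≈a' n) (+-congʳ a≈a')

  -- (a)_m (b)_m / (m! (k+m)!): the coefficient of z^m in  ₂F₁(a, b; k+1; z) / k!
  hyp : Carrier → Carrier → ℕ → ℕ → Carrier
  hyp a b k m = poch a m * poch b m * invFact m * invFact (k N.+ m)

  hyp-cong : ∀ {a a' b b'} → a ≈ a' → b ≈ b' → ∀ k m → hyp a b k m ≈ hyp a' b' k m
  hyp-cong a≈a' b≈b' k m = *-congʳ (*-congʳ (*-cong (poch-cong a≈a' m) (poch-cong b≈b' m)))

  oneMinusPow-cong : ∀ {β β'} → β ≈ β' → ∀ n → oneMinusPow β n ≈ oneMinusPow β' n
  oneMinusPow-cong β≈β' n = *-congʳ (poch-cong (-‿cong β≈β') n)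

  ωcoeff : Carrier → ℕ → Carrier
  ωcoeff t k = poch (ω * t) k * poch ((ω * ω) * t) k * invFact k

  B-expansion : ∀ a t n → B a t n ≈ sumTo (λ k → ωcoeff t k * hyp (a + t) ((a - t) + nat k) k (n N.∸ k)) n
  B-expansion a t n = trans (sumTo-*ˡ (invFact n) _ n) (sumTo-cong n λ k k≤n → trans
    (*-congʳ (reflexive (P.cong invFact (P.sym (NP.m+[n∸m]≡n k≤n)))))
    (solve 7 (λ i w₁ w₂ p₁ p₂ iₖ iₘ → i :* (w₁ :* w₂ :* p₁ :* p₂ :* (iₖ :* iₘ))
                := w₁ :* w₂ :* iₖ :* (p₁ :* p₂ :* iₘ :* i)) refl
       (invFact (k N.+ (n N.∸ k))) (poch (ω * t) k) (poch ((ω * ω) * t) k)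
       (poch (a + t) (n N.∸ k)) (poch ((a - t) + nat k) (n N.∸ k)) (invFact k) (invFact (n N.∸ k))))

  module WithInverses (inv-spec : ∀ n → nat (suc n) * inv n ≈ 1#) where

    inv-spec-+ : ∀ k m → (1# + (nat k + nat m)) * inv (k N.+ m) ≈ 1#
    inv-spec-+ k m = trans (*-congʳ (+-congˡ (sym (nat-+ k m)))) (inv-spec (k N.+ m))

    hyp-recurrence : ∀ a b k m →
      (1# + nat m) * (1# + (nat k + nat m)) * hyp a b k (suc m)
        ≈ (a + nat m) * (b + nat m) * hyp a b k m
    hyp-recurrence a b k m = begin
      (1# + M) * (1# + (K + M)) * (pa * am * (pb * bm) * (im * u) * invFact (k N.+ suc m))
        ≡⟨ P.cong (λ i → (1# + M) * (1# + (K + M)) * (pa * am * (pb * bm) * (im * u) * invFact i))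
                  (NP.+-suc k m) ⟩
      (1# + M) * (1# + (K + M)) * (pa * am * (pb * bm) * (im * u) * (ikm * v))
        ≈⟨ solve 10 (λ M K pa A pb B im u ikm v →
             (con (+ 1) :+ M) :* (con (+ 1) :+ (K :+ M)) :* (pa :* A :* (pb :* B) :* (im :* u) :* (ikm :* v))
             := A :* B :* (pa :* pb :* im :* ikm) :* (((con (+ 1) :+ M) :* u) :* ((con (+ 1) :+ (K :+ M)) :* v)))
             refl M K pa am pb bm im u ikm v ⟩
      am * bm * hyp a b k m * (((1# + M) * u) * ((1# + (K + M)) * v))
        ≈⟨ *-congˡ (*-cong (inv-spec m) (inv-spec-+ k m)) ⟩
      am * bm * hyp a b k m * (1# * 1#)
        ≈⟨ trans (*-congˡ (*-identityʳ 1#)) (*-identityʳ _) ⟩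
      am * bm * hyp a b k m ∎
      where
      M K pa pb am bm im u ikm v : Carrier
      M = nat m
      K = nat k
      pa = poch a m
      pb = poch b m
      am = a + M
      bm = b + M
      im = invFact m
      u = inv m
      ikm = invFact (k N.+ m)
      v = inv (k N.+ m)

    binomial-step : ∀ β j → oneMinusPow β (suc j) * nat (suc j) ≈ oneMinusPow β j * (- β + nat j)
    binomial-step β j = trans
      (solve 5 (λ p x i u n → p :* x :* (i :* u) :* n := p :* i :* x :* (n :* u)) refl
         (poch (- β) j) (- β + nat j) (invFact j) (inv j) (nat (suc j)))
      (trans (*-congˡ (inv-spec j)) (*-identityʳ _))

    -- Euler's transformation  ₂F₁(a, b; c; z) = (1-z)^(c-a-b) ₂F₁(c-b, c-a; c; z)
    -- for c = k+1, as an identity of coefficient sequences.  Both sides satisfy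
    -- the hypergeometric recurrence of the left side; for the right side this
    -- is shown by creative telescoping.
    module Euler (a b : Carrier) (k : ℕ) where
      K β a' b' : Carrier
      K = nat k
      β = (1# + K) - a - b
      a' = (1# + K) - b
      b' = (1# + K) - a

      S : ℕ → Carrier
      S = oneMinusPow β ⋆ hyp a' b' k

      -- leading and trailing coefficients of the recurrence, and the weight
      -- appearing in the telescoping certificate, as functions of n = nat N
      lead trail weight : Carrier → Carrier
      lead n = (1# + n) * (1# + (K + n))
      trail n = (a + n) * (b + n)
      weight n = ((K + n) + n) + (1# + 1#)

      weight-cong : ∀ {n n'} → n ≈ n' → weight n ≈ weight n'
      weight-cong n≈n' = +-congʳ (+-cong (+-congˡ n≈n') n≈n')

      -- the two polynomial identities behind the telescoping certificate,
      -- for n = j + m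
      lead-identity : ∀ {n} j m → n ≈ j + m →
                      lead n + j * (j - weight n) ≈ (1# + m) * (1# + (K + m))
      lead-identity {n} j m n≈j+m = begin
        lead n + j * (j - weight n)
          ≈⟨ +-cong (*-cong (+-congˡ n≈j+m) (+-congˡ (+-congˡ n≈j+m)))
                    (*-congˡ (+-congˡ (-‿cong (weight-cong n≈j+m)))) ⟩
        lead (j + m) + j * (j - weight (j + m))
          ≈⟨ solve 3 (λ K j m →
               (con (+ 1) :+ (j :+ m)) :* (con (+ 1) :+ (K :+ (j :+ m)))
                 :+ j :* (j :- (((K :+ (j :+ m)) :+ (j :+ m)) :+ (con (+ 1) :+ con (+ 1))))
               := (con (+ 1) :+ m) :* (con (+ 1) :+ (K :+ m))) refl K j m ⟩
        (1# + m) * (1# + (K + m)) ∎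

      trail-identity : ∀ {n} j m → n ≈ j + m →
                       trail n + (- β + j) * ((1# + j) - weight n) ≈ (a' + m) * (b' + m)
      trail-identity {n} j m n≈j+m = begin
        trail n + (- β + j) * ((1# + j) - weight n)
          ≈⟨ +-cong (*-cong (+-congˡ n≈j+m) (+-congˡ n≈j+m))
                    (*-congˡ (+-congˡ (-‿cong (weight-cong n≈j+m)))) ⟩
        trail (j + m) + (- β + j) * ((1# + j) - weight (j + m))
          ≈⟨ solve 5 (λ a b K j m →
               (a :+ (j :+ m)) :* (b :+ (j :+ m))
                 :+ (:- (((con (+ 1) :+ K) :- a) :- b) :+ j)
                    :* ((con (+ 1) :+ j) :- (((K :+ (j :+ m)) :+ (j :+ m)) :+ (con (+ 1) :+ con (+ 1))))
               := (((con (+ 1) :+ K) :- b) :+ m) :* (((con (+ 1) :+ K) :- a) :+ m)) refl a b K j m ⟩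
        (a' + m) * (b' + m) ∎

      module Telescoping (N : ℕ) where
        n : Carrier
        n = nat N

        term term' certificate : ℕ → Carrier
        term j = oneMinusPow β j * hyp a' b' k (suc N N.∸ j)
        term' j = oneMinusPow β j * hyp a' b' k (N N.∸ j)
        certificate j = oneMinusPow β j * nat j * hyp a' b' k (suc N N.∸ j) * (nat j - weight n)

        certificate-step : ∀ j → j ≤ N →
          lead n * term j + certificate j ≈ trail n * term' j + certificate (suc j)
        certificate-step j j≤N = begin
          lead n * (p * hyp a' b' k (suc N N.∸ j)) + p * J * hyp a' b' k (suc N N.∸ j) * (J - weight n)
            ≡⟨ P.cong (λ i → lead n * (p * hyp a' b' k i) + p * J * hyp a' b' k i * (J - weight n))
                      (suc-∸ j≤N) ⟩
          lead n * (p * h₁) + p * J * h₁ * (J - weight n)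
            ≈⟨ solve 5 (λ L W p J h₁ → L :* (p :* h₁) :+ p :* J :* h₁ :* (J :- W)
                                      := p :* ((L :+ J :* (J :- W)) :* h₁)) refl
                 (lead n) (weight n) p J h₁ ⟩
          p * ((lead n + J * (J - weight n)) * h₁)
            ≈⟨ *-congˡ (*-congʳ (lead-identity J M n≈J+M)) ⟩
          p * ((1# + M) * (1# + (K + M)) * h₁)
            ≈⟨ *-congˡ (hyp-recurrence a' b' k m) ⟩
          p * ((a' + M) * (b' + M) * h₀)
            ≈⟨ *-congˡ (*-congʳ (trail-identity J M n≈J+M)) ⟨
          p * ((trail n + (- β + J) * ((1# + J) - weight n)) * h₀)
            ≈⟨ solve 6 (λ T W p J c h₀ → p :* ((T :+ c :* ((con (+ 1) :+ J) :- W)) :* h₀)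
                                        := T :* (p :* h₀) :+ p :* c :* h₀ :* ((con (+ 1) :+ J) :- W)) refl
                 (trail n) (weight n) p J (- β + J) h₀ ⟩
          trail n * (p * h₀) + p * (- β + J) * h₀ * ((1# + J) - weight n)
            ≈⟨ +-congˡ (*-congʳ (*-congʳ (binomial-step β j))) ⟨
          trail n * term' j + certificate (suc j) ∎
          where
          p J M h₀ h₁ : Carrier
          m : ℕ
          p = oneMinusPow β j
          J = nat j
          m = N N.∸ j
          M = nat m
          h₀ = hyp a' b' k m
          h₁ = hyp a' b' k (suc m)
          n≈J+M : n ≈ J + M
          n≈J+M = trans (reflexive (P.cong nat (P.sym (NP.m+[n∸m]≡n j≤N)))) (nat-+ j m)

        certificate-first : certificate 0 ≈ 0#
        certificate-first = solve 3 (λ p h W → p :* con (+ 0) :* h :* (con (+ 0) :- W) := con (+ 0)) refl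
                              (oneMinusPow β 0) (hyp a' b' k (suc N)) (weight n)

        certificate-last : lead n * term (suc N) + certificate (suc N) ≈ 0#
        certificate-last = solve 4 (λ p h K n →
          (con (+ 1) :+ n) :* (con (+ 1) :+ (K :+ n)) :* (p :* h)
            :+ p :* (con (+ 1) :+ n) :* h
               :* ((con (+ 1) :+ n) :- (((K :+ n) :+ n) :+ (con (+ 1) :+ con (+ 1))))
          := con (+ 0)) refl (oneMinusPow β (suc N)) (hyp a' b' k (suc N N.∸ suc N)) K n

        recurrence : lead n * S (suc N) ≈ trail n * S N
        recurrence = begin
          lead n * (sumTo term N + term (suc N))
            ≈⟨ trans (distribˡ _ _ _) (+-congʳ (sumTo-*ˡ (lead n) term N)) ⟩
          sumTo (λ j → lead n * term j) N + lead n * term (suc N)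
            ≈⟨ +-congʳ (trans (+-congˡ certificate-first) (+-identityʳ _)) ⟨
          (sumTo (λ j → lead n * term j) N + certificate 0) + lead n * term (suc N)
            ≈⟨ +-congʳ (telescope _ _ certificate N certificate-step) ⟩
          (sumTo (λ j → trail n * term' j) N + certificate (suc N)) + lead n * term (suc N)
            ≈⟨ trans (+-assoc _ _ _) (+-congˡ (+-comm _ _)) ⟩
          sumTo (λ j → trail n * term' j) N + (lead n * term (suc N) + certificate (suc N))
            ≈⟨ trans (+-congˡ certificate-last) (+-identityʳ _) ⟩
          sumTo (λ j → trail n * term' j) N
            ≈⟨ sumTo-*ˡ (trail n) term' N ⟨
          trail n * S N ∎

      euler : ∀ N → hyp a b k N ≈ S N
      euler = recurrence-unique (λ N → lead (nat N)) (λ N → inv N * inv (k N.+ N))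
                (λ N → trail (nat N)) (hyp a b k) S inverse (hyp-recurrence a b k)
                Telescoping.recurrence base
        where
        inverse : ∀ N → inv N * inv (k N.+ N) * lead (nat N) ≈ 1#
        inverse N = begin
          inv N * inv (k N.+ N) * lead (nat N)
            ≈⟨ solve 4 (λ u v K n → u :* v :* ((con (+ 1) :+ n) :* (con (+ 1) :+ (K :+ n)))
                                    := ((con (+ 1) :+ n) :* u) :* ((con (+ 1) :+ (K :+ n)) :* v))
                 refl (inv N) (inv (k N.+ N)) K (nat N) ⟩
          (nat (suc N) * inv N) * ((1# + (K + nat N)) * inv (k N.+ N))
            ≈⟨ *-cong (inv-spec N) (inv-spec-+ k N) ⟩
          1# * 1#
            ≈⟨ *-identityʳ 1# ⟩
          1# ∎
        base : hyp a b k 0 ≈ S 0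
        base = solve 1 (λ x → con (+ 1) :* con (+ 1) :* con (+ 1) :* x
                              := (con (+ 1) :* con (+ 1)) :* (con (+ 1) :* con (+ 1) :* con (+ 1) :* x))
                 refl (invFact (k N.+ 0))

    euler-shifted : ∀ α t k m →
      hyp (α + t) ((α - t) + nat k) k m
        ≈ (oneMinusPow (1# - (α + α)) ⋆ hyp ((1# - α) + t) (((1# - α) - t) + nat k) k) m
    euler-shifted α t k m = trans (Euler.euler (α + t) ((α - t) + nat k) k m)
      (⋆-cong (oneMinusPow-cong exponent) (hyp-cong upper₁ upper₂ k) m)
      where
      K : Carrier
      K = nat k
      exponent : (1# + K) - (α + t) - ((α - t) + K) ≈ 1# - (α + α)
      exponent = solve 3 (λ α t K → ((con (+ 1) :+ K) :- (α :+ t)) :- ((α :- t) :+ K)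
                                    := con (+ 1) :- (α :+ α)) refl α t K
      upper₁ : (1# + K) - ((α - t) + K) ≈ (1# - α) + t
      upper₁ = solve 3 (λ α t K → (con (+ 1) :+ K) :- ((α :- t) :+ K) := (con (+ 1) :- α) :+ t) refl α t K
      upper₂ : (1# + K) - (α + t) ≈ ((1# - α) - t) + K
      upper₂ = solve 3 (λ α t K → (con (+ 1) :+ K) :- (α :+ t) := ((con (+ 1) :- α) :- t) :+ K) refl α t K

import Relation.Binary.Reasoning.Setoid as SetoidReasoning

lemma5 : ∀ {c ℓ} (R : CommutativeRing c ℓ) → let open CommutativeRing R in
         (ω : Carrier) (inv : ℕ → Carrier) → let open Series R ω inv in
         ((ω * ω + ω) + 1# ≈ 0#) →
         (∀ n → nat (suc n) * inv n ≈ 1#) →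
         ∀ (α t : Carrier) (n : ℕ) →
         B α t n ≈ (oneMinusPow (1# - (α + α)) ⋆ B (1# - α) t) n
lemma5 R ω inv _ inv-spec α t n = begin
  B α t n
    ≈⟨ B-expansion α t n ⟩
  sumTo (λ k → ωcoeff t k * hyp (α + t) ((α - t) + nat k) k (n N.∸ k)) n
    ≈⟨ sumTo-cong n (λ k _ → *-congˡ (euler-shifted α t k (n N.∸ k))) ⟩
  sumTo (λ k → ωcoeff t k * (P ⋆ H k) (n N.∸ k)) n
    ≈⟨ ⋆-pull (ωcoeff t) P H n ⟩
  (P ⋆ (λ m → sumTo (λ k → ωcoeff t k * H k (m N.∸ k)) m)) n
    ≈⟨ ⋆-cong (λ _ → refl) (λ m → sym (B-expansion (1# - α) t m)) n ⟩
  (P ⋆ B (1# - α) t) n ∎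
  where
  open CommutativeRing R
  open Series R ω inv
  open Development R ω inv
  open WithInverses inv-spec
  open SetoidReasoning setoid
  P : ℕ → Carrier
  P = oneMinusPow (1# - (α + α))
  H : ℕ → ℕ → Carrier
  H k = hyp ((1# - α) + t) (((1# - α) - t) + nat k) k
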